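{- Let $k,\ell$ be integers with $2 \leq \ell \leq k$, and let $T$ be a subdivision of $K_k$. Then $T$ contains a subgraph which is a subdivision of $K_\ell$ and which contains all branch vertices of $T$.
   Context: A subdivision of a graph $F$ is a graph obtained from $F$ by replacing its edges with internally vertex-disjoint paths between their endpoints; the branch vertices of the subdivision are the vertices corresponding to the vertices of $F$. $K_m$ denotes the complete graph on $m$ vertices. -}

module Defs where

open import Level using (0ℓ)
open import Data.Nat using (ℕ; suc)
open import Data.Fin using (Fin; _<_)
open import Data.List using (List; []; _∷_)
open import Data.List.Membership.Propositional using (_∈_)
open import Data.List.Relation.Unary.Unique.Propositional using (Unique)
open import Data.Product using (Σ; _×_; ∃; _,_)
open import Data.Sum using (_⊎_)
open import Relation.Binary.PropositionalEquality using (_≡_; _≢_)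
open import Relation.Nullary using (¬_)
open import Function.Definitions using (Injective)

record Graph (n : ℕ) : Set₁ where
  field
    Adj    : Fin n → Fin n → Set
    sym    : ∀ {u v} → Adj u v → Adj v u
    irrefl : ∀ {u} → ¬ Adj u u
open Graph public

data Walk {n : ℕ} (G : Graph n) : Fin n → Fin n → List (Fin n) → Set where
  here : ∀ {u} → Walk G u u (u ∷ [])
  step : ∀ {u w v ps} → Adj G u w → Walk G w v ps → Walk G u v (u ∷ ps)

IsPath : {n : ℕ} → Graph n → Fin n → Fin n → List (Fin n) → Set
IsPath G u v ps = Walk G u v ps × Unique ps

data EdgeOn {n : ℕ} (u v : Fin n) : List (Fin n) → Set where
  fwd  : ∀ {ps} → EdgeOn u v (u ∷ v ∷ ps)
  bwd  : ∀ {ps} → EdgeOn u v (v ∷ u ∷ ps)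
  there : ∀ {x ps} → EdgeOn u v ps → EdgeOn u v (x ∷ ps)

-- The subgraph is the union of the paths.
record TopK {n : ℕ} (G : Graph n) (m : ℕ) : Set where
  field
    branch     : Fin m → Fin n
    branch-inj : Injective _≡_ _≡_ branch
    path       : (i j : Fin m) → i < j → List (Fin n)
    isPath     : ∀ i j (p : i < j) → IsPath G (branch i) (branch j) (path i j p)

  Internal : Fin n → (i j : Fin m) → i < j → Set
  Internal x i j p = x ∈ path i j p × x ≢ branch i × x ≢ branch j

  field
    internal-not-branch : ∀ {x i j} {p : i < j} → Internal x i j p → ∀ a → x ≢ branch a
    internal-disjoint   : ∀ {x i j i' j'} {p : i < j} {p' : i' < j'} →
                          Internal x i j p → x ∈ path i' j' p' → (i ≡ i' × j ≡ j')

  VertexOf : Fin n → Set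
  VertexOf x = Σ (Fin m) λ i → Σ (Fin m) λ j → Σ (i < j) λ p → x ∈ path i j p

  EdgeOf : Fin n → Fin n → Set
  EdgeOf u v = Σ (Fin m) λ i → Σ (Fin m) λ j → Σ (i < j) λ p → EdgeOn u v (path i j p)
open TopK public

record Subdivision {n : ℕ} (G : Graph n) (m : ℕ) : Set where
  field
    topK       : TopK G m
    covers-V   : ∀ x → VertexOf topK x
    covers-E   : ∀ {u v} → Adj G u v → EdgeOf topK u v
open Subdivision public

branchOf : {n m : ℕ} {G : Graph n} → Subdivision G m → Fin m → Fin n
branchOf S = branch (topK S)

-- Merging the paths b₀–b₁ and b₁–b₂ of a topological K_{m+1} into a single
-- path b₀–b₂ through b₁, and discarding the other paths at b₁, yields a
-- topological K_m whose paths still cover the old path b₀–b₁. Starting from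
-- the subdivision T of K_k and repeating this k − ℓ times, every branch
-- vertex of T remains either a branch vertex or a vertex of the path between
-- the first two branch vertices.
module Submission where

open import Defs hiding (sym)
open import Data.Nat using (ℕ; _≤_; _≤′_; ≤′-refl; ≤′-step; suc; zero; z≤n; s≤s; z<s)
open import Data.Nat.Properties using (≤⇒≤′)
open import Data.Fin using (Fin; zero; suc; punchIn; _≟_) renaming (_<_ to _<ᶠ_)
open import Data.Fin.Properties using (punchIn-injective; punchInᵢ≢i)
open import Data.Product using (Σ; ∃; _,_; _×_; proj₁; proj₂)
open import Data.Sum using (_⊎_; inj₁; inj₂)
open import Data.Empty using (⊥-elim)
open import Data.List using (List; _∷_; _++_; drop)
open import Data.List.Membership.Propositional using (_∈_; _∉_)
open import Data.List.Membership.Propositional.Properties using (∈-++⁻; ∈-++⁺ˡ)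
open import Data.List.Relation.Unary.Any using (here; there)
open import Data.List.Relation.Unary.All as All using ()
open import Data.List.Relation.Unary.AllPairs using (_∷_)
open import Data.List.Relation.Unary.Unique.Propositional.Properties using (++⁺; drop⁺)
open import Relation.Binary.PropositionalEquality using (_≡_; _≢_; refl; sym; trans; subst)
open import Relation.Nullary using (yes; no)

∈-drop₁⁻ : ∀ {A : Set} {x : A} xs → x ∈ drop 1 xs → x ∈ xs
∈-drop₁⁻ (_ ∷ _) x∈ = there x∈

punchIn-mono-< : ∀ {m} i (j k : Fin m) → j <ᶠ k → punchIn i j <ᶠ punchIn i k
punchIn-mono-< zero    j       k       j<k       = s≤s j<k
punchIn-mono-< (suc i) zero    (suc k) _         = z<s
punchIn-mono-< (suc i) (suc j) (suc k) (s≤s j<k) = s≤s (punchIn-mono-< i j k j<k)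

module _ {n : ℕ} {G : Graph n} where

  walk-++ : ∀ {u v w ps qs} → Walk G u v ps → Walk G v w qs → Walk G u w (ps ++ drop 1 qs)
  walk-++ here here          = here
  walk-++ here (step uw wv)  = step uw wv
  walk-++ (step uw wv) vw    = step uw (walk-++ wv vw)

  walk-first∈ : ∀ {u v ps} → Walk G u v ps → u ∈ ps
  walk-first∈ here       = here refl
  walk-first∈ (step _ _) = here refl

  walk-last∈ : ∀ {u v ps} → Walk G u v ps → v ∈ ps
  walk-last∈ here        = here refl
  walk-last∈ (step _ wv) = there (walk-last∈ wv)

  path-first∉drop₁ : ∀ {u v ps} → IsPath G u v ps → u ∉ drop 1 ps
  path-first∉drop₁ (here , _)            ()
  path-first∉drop₁ (step _ _ , u∉ ∷ _) u∈ = All.lookup u∉ u∈ refl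

module _ {m : ℕ} where

  skip₁ : Fin (suc (suc m)) → Fin (suc (suc (suc m)))
  skip₁ = punchIn (suc zero)

  -- Path (i, j) of the contraction is path (skip₁ i, skip₁ j) of the original,
  -- except for (0, 1), which becomes the merged path b₀–b₁–b₂.
  data Origin : Fin (suc (suc m)) → Fin (suc (suc m)) → Set where
    merged : Origin zero (suc zero)
    kept   : ∀ {i j} → Origin i j

  origin : ∀ i j → Origin i j
  origin zero (suc zero) = merged
  origin _    _          = kept

module Contract {n m : ℕ} {T : Graph n} (M : TopK T (suc (suc (suc m)))) where

  private
    b = branch M
    P = path M

    b-skip₁≢b₁ : ∀ a → b (skip₁ a) ≢ b (suc zero)
    b-skip₁≢b₁ a e = punchInᵢ≢i (suc zero) a (branch-inj M e)

    b₀≢b₂ : b zero ≢ b (suc (suc zero))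
    b₀≢b₂ e with branch-inj M e
    ... | ()

  P₀₁ P₁₂ P₀₁₂ : List (Fin n)
  P₀₁  = P zero (suc zero) z<s
  P₁₂  = P (suc zero) (suc (suc zero)) (s≤s z<s)
  P₀₁₂ = P₀₁ ++ drop 1 P₁₂

  drop₁-P₁₂-avoids-b₁ : ∀ {x} → x ∈ drop 1 P₁₂ → x ≢ b (suc zero)
  drop₁-P₁₂-avoids-b₁ x∈ x≡b₁ = path-first∉drop₁ (isPath M _ _ _) (subst (_∈ _) x≡b₁ x∈)

  P₀₁-disjoint-drop₁-P₁₂ : ∀ {x} → x ∈ P₀₁ → x ∉ drop 1 P₁₂
  P₀₁-disjoint-drop₁-P₁₂ {x} x∈P₀₁ x∈ with x ≟ b zero
  ... | yes x≡b₀ =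
    internal-not-branch M (∈-drop₁⁻ P₁₂ x∈ , drop₁-P₁₂-avoids-b₁ x∈ , λ x≡b₂ → b₀≢b₂ (trans (sym x≡b₀) x≡b₂))
                        zero x≡b₀
  ... | no x≢b₀ with internal-disjoint M (x∈P₀₁ , x≢b₀ , drop₁-P₁₂-avoids-b₁ x∈) (∈-drop₁⁻ P₁₂ x∈)
  ...   | ()

  P₀₁₂-isPath : IsPath T (b zero) (b (suc (suc zero))) P₀₁₂
  P₀₁₂-isPath with isPath M zero (suc zero) z<s | isPath M (suc zero) (suc (suc zero)) (s≤s z<s)
  ... | walk₀₁ , unique₀₁ | walk₁₂ , unique₁₂ =
    walk-++ walk₀₁ walk₁₂ , ++⁺ unique₀₁ (drop⁺ 1 unique₁₂) λ (x∈P₀₁ , x∈) → P₀₁-disjoint-drop₁-P₁₂ x∈P₀₁ x∈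

  P₀₁₂-interior : ∀ {x} → x ∈ P₀₁₂ → x ≢ b zero → x ≢ b (suc (suc zero)) →
                  x ≡ b (suc zero) ⊎ Internal M x zero (suc zero) z<s
                                   ⊎ Internal M x (suc zero) (suc (suc zero)) (s≤s z<s)
  P₀₁₂-interior {x} x∈ x≢b₀ x≢b₂ with ∈-++⁻ P₀₁ x∈ | x ≟ b (suc zero)
  ... | _           | yes x≡b₁ = inj₁ x≡b₁
  ... | inj₁ x∈P₀₁ | no x≢b₁  = inj₂ (inj₁ (x∈P₀₁ , x≢b₀ , x≢b₁))
  ... | inj₂ x∈    | no x≢b₁  = inj₂ (inj₂ (∈-drop₁⁻ P₁₂ x∈ , x≢b₁ , x≢b₂))

  path′ : ∀ i j → i <ᶠ j → List (Fin n)
  path′ i j i<j with origin i j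
  ... | merged = P₀₁₂
  ... | kept   = P (skip₁ i) (skip₁ j) (punchIn-mono-< (suc zero) i j i<j)

  isPath′ : ∀ i j (i<j : i <ᶠ j) → IsPath T (b (skip₁ i)) (b (skip₁ j)) (path′ i j i<j)
  isPath′ i j i<j with origin i j
  ... | merged = P₀₁₂-isPath
  ... | kept   = isPath M (skip₁ i) (skip₁ j) _

  Internal′ : Fin n → ∀ i j → i <ᶠ j → Set
  Internal′ x i j i<j = x ∈ path′ i j i<j × x ≢ b (skip₁ i) × x ≢ b (skip₁ j)

  internal′-not-branch : ∀ {x i j} {i<j : i <ᶠ j} → Internal′ x i j i<j → ∀ a → x ≢ b (skip₁ a)
  internal′-not-branch {x} {i} {j} (x∈ , x≢bi , x≢bj) a with origin i j
  ... | kept = internal-not-branch M (x∈ , x≢bi , x≢bj) (skip₁ a)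
  ... | merged with P₀₁₂-interior x∈ x≢bi x≢bj
  ...   | inj₁ x≡b₁           = λ x≡ba → b-skip₁≢b₁ a (trans (sym x≡ba) x≡b₁)
  ...   | inj₂ (inj₁ internal) = internal-not-branch M internal (skip₁ a)
  ...   | inj₂ (inj₂ internal) = internal-not-branch M internal (skip₁ a)

  internal′-disjoint : ∀ {x i j i′ j′} {i<j : i <ᶠ j} {i′<j′ : i′ <ᶠ j′} →
                       Internal′ x i j i<j → x ∈ path′ i′ j′ i′<j′ → i ≡ i′ × j ≡ j′
  internal′-disjoint {x} {i} {j} {i′} {j′} (x∈ , x≢bi , x≢bj) x∈′ with origin i j | origin i′ j′
  ... | merged | merged = refl , refl
  ... | kept   | kept with internal-disjoint M (x∈ , x≢bi , x≢bj) x∈′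
  ...   | i≡i′ , j≡j′ = punchIn-injective (suc zero) i i′ i≡i′ , punchIn-injective (suc zero) j j′ j≡j′
  internal′-disjoint {x} {i} {j} {i′} {j′} (x∈ , x≢bi , x≢bj) x∈′ | merged | kept
    with P₀₁₂-interior x∈ x≢bi x≢bj
  ... | inj₁ x≡b₁ = ⊥-elim (internal-not-branch M (subst (_∈ _) x≡b₁ x∈′ , b₁≢ i′ , b₁≢ j′) (suc zero) refl)
    where b₁≢ = λ a b₁≡ → b-skip₁≢b₁ a (sym b₁≡)
  ... | inj₂ (inj₁ internal) = ⊥-elim (punchInᵢ≢i (suc zero) j′ (sym (proj₂ (internal-disjoint M internal x∈′))))
  ... | inj₂ (inj₂ internal) = ⊥-elim (punchInᵢ≢i (suc zero) i′ (sym (proj₁ (internal-disjoint M internal x∈′))))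
  internal′-disjoint {x} {i} {j} {i′} {j′} (x∈ , x≢bi , x≢bj) x∈′ | kept | merged with ∈-++⁻ P₀₁ x∈′
  ... | inj₁ x∈P₀₁ = ⊥-elim (punchInᵢ≢i (suc zero) j (proj₂ (internal-disjoint M internal x∈P₀₁)))
    where internal = x∈ , x≢bi , x≢bj
  ... | inj₂ x∈P₁₂ = ⊥-elim (punchInᵢ≢i (suc zero) i (proj₁ (internal-disjoint M internal (∈-drop₁⁻ P₁₂ x∈P₁₂))))
    where internal = x∈ , x≢bi , x≢bj

  contract : TopK T (suc (suc m))
  contract = record
    { branch              = λ a → b (skip₁ a)
    ; branch-inj          = λ e → punchIn-injective (suc zero) _ _ (branch-inj M e)
    ; path                = path′
    ; isPath              = isPath′
    ; internal-not-branch = internal′-not-branch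
    ; internal-disjoint   = internal′-disjoint
    }

open Contract using (contract)

module _ {n : ℕ} {T : Graph n} where

  Anchored : ∀ {m} → TopK T (suc (suc m)) → Fin n → Set
  Anchored M y = (∃ λ a → y ≡ branch M a) ⊎ y ∈ path M zero (suc zero) z<s

  anchored-contract : ∀ {m y} (M : TopK T (suc (suc (suc m)))) → Anchored M y → Anchored (contract M) y
  anchored-contract M (inj₁ (zero , y≡b₀))        = inj₁ (zero , y≡b₀)
  anchored-contract M (inj₁ (suc zero , y≡b₁))    =
    inj₂ (∈-++⁺ˡ (subst (_∈ _) (sym y≡b₁) (walk-last∈ (proj₁ (isPath M zero (suc zero) z<s)))))
  anchored-contract M (inj₁ (suc (suc a) , y≡b))  = inj₁ (suc a , y≡b)
  anchored-contract M (inj₂ y∈P₀₁)                = inj₂ (∈-++⁺ˡ y∈P₀₁)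

  shrink : ∀ {l N} → l ≤′ N → TopK T (suc (suc N)) → TopK T (suc (suc l))
  shrink ≤′-refl      M = M
  shrink (≤′-step l≤N) M = shrink l≤N (contract M)

  anchored-shrink : ∀ {l N y} (l≤N : l ≤′ N) (M : TopK T (suc (suc N))) →
                    Anchored M y → Anchored (shrink l≤N M) y
  anchored-shrink ≤′-refl       M anchored = anchored
  anchored-shrink (≤′-step l≤N) M anchored = anchored-shrink l≤N (contract M) (anchored-contract M anchored)

  anchored⇒VertexOf : ∀ {m y} (M : TopK T (suc (suc m))) → Anchored M y → VertexOf M y
  anchored⇒VertexOf M (inj₂ y∈P₀₁)          = zero , suc zero , z<s , y∈P₀₁
  anchored⇒VertexOf M (inj₁ (zero , y≡b₀))  =
    zero , suc zero , z<s , subst (_∈ _) (sym y≡b₀) (walk-first∈ (proj₁ (isPath M zero (suc zero) z<s)))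
  anchored⇒VertexOf M (inj₁ (suc a , y≡b))  =
    zero , suc a , z<s , subst (_∈ _) (sym y≡b) (walk-last∈ (proj₁ (isPath M zero (suc a) z<s)))

proposition3 : ∀ {n : ℕ} (k ℓ : ℕ) → 2 ≤ ℓ → ℓ ≤ k →
               (T : Graph n) → (S : Subdivision T k) →
               Σ (TopK T ℓ) λ M → ∀ (i : Fin k) → VertexOf M (branchOf S i)
proposition3 (suc (suc k)) (suc (suc l)) (s≤s (s≤s z≤n)) (s≤s (s≤s l≤k)) T S =
  shrink l≤′k (topK S) ,
  λ i → anchored⇒VertexOf (shrink l≤′k (topK S)) (anchored-shrink l≤′k (topK S) (inj₁ (i , refl)))
  where l≤′k = ≤⇒≤′ l≤k
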